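{- Let $\mathbf{ILX}$ be a logic extending $\mathbf{IL}$ that contains every instance of $\mathsf W$: $A\rhd B\to A\rhd B\wedge\Box\neg A$. If $\Gamma,\Lambda$ are $\mathbf{ILX}$-MCSs and $S$ a set of formulas with $B\rhd C\in\Gamma$, $\Gamma\prec_S\Lambda$ and $B\in\Lambda$, then there exists an $\mathbf{ILX}$-MCS $\Delta$ with $\Gamma\prec_{S\cup\{\Box\neg B\}}\Delta$ and $C,\Box\neg C\in\Delta$.
   Context: Formulas: $\bot$, propositional variables, $\to$, $\Box$, binary $\rhd$; $\Diamond A:=\neg\Box\neg A$. $\mathbf{IL}$: classical tautologies, K, L: $\Box(\Box A\to A)\to\Box A$, J1: $\Box(A\to B)\to A\rhd B$, J2: $(A\rhd B)\wedge(B\rhd C)\to A\rhd C$, J3: $(A\rhd C)\wedge(B\rhd C)\to A\vee B\rhd C$, J4: $A\rhd B\to(\Diamond A\to\Diamond B)$, J5: $\Diamond A\rhd A$; rules modus ponens and necessitation. An $\mathbf{ILX}$-MCS is a maximal $\mathbf{ILX}$-consistent set. $\Gamma\prec_S\Delta$ iff for every formula $A$ and finite $S'\subseteq S$, $\neg A\rhd\bigvee_{\sigma\in S'}\neg\sigma\in\Gamma$ implies $A,\Box A\in\Delta$ (empty disjunction is $\bot$). -}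

module Defs where

open import Data.Nat using (ℕ)
open import Data.Bool using (Bool; true; false; not; _∨_)
open import Data.List using (List; []; _∷_)
open import Data.List.Relation.Unary.All using (All)
open import Data.Product using (Σ; _×_)
open import Data.Sum using (_⊎_)
open import Relation.Binary.PropositionalEquality using (_≡_)
open import Relation.Nullary using (¬_)

infixr 6 _⇒_
infix 7 _▷_
infixr 8 _∧'_ _∨'_

data Fm : Set where
  var : ℕ → Fm
  ⊥'  : Fm
  _⇒_ : Fm → Fm → Fm
  □   : Fm → Fm
  _▷_ : Fm → Fm → Fm

¬' : Fm → Fm
¬' A = A ⇒ ⊥'

_∨'_ : Fm → Fm → Fm
A ∨' B = ¬' A ⇒ B

_∧'_ : Fm → Fm → Fm
A ∧' B = ¬' (A ⇒ ¬' B)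

◇ : Fm → Fm
◇ A = ¬' (□ (¬' A))

eval : (Fm → Bool) → Fm → Bool
eval v (var n) = v (var n)
eval v ⊥' = false
eval v (A ⇒ B) = not (eval v A) ∨ eval v B
eval v (□ A) = v (□ A)
eval v (A ▷ B) = v (A ▷ B)

Tautology : Fm → Set
Tautology A = (v : Fm → Bool) → eval v A ≡ true

data ILAxiom : Fm → Set where
  taut : ∀ {A} → Tautology A → ILAxiom A
  axK  : ∀ A B → ILAxiom (□ (A ⇒ B) ⇒ □ A ⇒ □ B)
  axL  : ∀ A → ILAxiom (□ (□ A ⇒ A) ⇒ □ A)
  axJ1 : ∀ A B → ILAxiom (□ (A ⇒ B) ⇒ A ▷ B)
  axJ2 : ∀ A B C → ILAxiom ((A ▷ B) ∧' (B ▷ C) ⇒ A ▷ C)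
  axJ3 : ∀ A B C → ILAxiom ((A ▷ C) ∧' (B ▷ C) ⇒ (A ∨' B) ▷ C)
  axJ4 : ∀ A B → ILAxiom (A ▷ B ⇒ (◇ A ⇒ ◇ B))
  axJ5 : ∀ A → ILAxiom (◇ A ▷ A)

record Logic : Set₁ where
  field
    Thm : Fm → Set
    ax  : ∀ {A} → ILAxiom A → Thm A
    mp  : ∀ {A B} → Thm (A ⇒ B) → Thm A → Thm B
    nec : ∀ {A} → Thm A → Thm (□ A)
open Logic public

W : Fm → Fm → Fm
W A B = A ▷ B ⇒ A ▷ (B ∧' □ (¬' A))

FmSet : Set₁
FmSet = Fm → Set

_⊆_ : FmSet → FmSet → Set
Γ ⊆ Δ = ∀ {A} → Γ A → Δ A

_⇒*_ : List Fm → Fm → Fm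
[] ⇒* B = B
(A ∷ As) ⇒* B = A ⇒ (As ⇒* B)

Consistent : Logic → FmSet → Set
Consistent L Γ = ¬ (Σ (List Fm) λ As → All Γ As × Thm L (As ⇒* ⊥'))

MCS : Logic → FmSet → Set₁
MCS L Γ = Consistent L Γ × ((Δ : FmSet) → Γ ⊆ Δ → Consistent L Δ → Δ ⊆ Γ)

⋁¬ : List Fm → Fm
⋁¬ [] = ⊥'
⋁¬ (σ ∷ σs) = ¬' σ ∨' ⋁¬ σs

Prec : FmSet → FmSet → FmSet → Set
Prec S Γ Δ = (A : Fm) (S' : List Fm) → All S S' →
  Γ (¬' A ▷ ⋁¬ S') → Δ A × Δ (□ A)

_∪｛_｝ : FmSet → Fm → FmSet
(S ∪｛ A ｝) x = S x ⊎ x ≡ A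

module Submission where

-- Write T = S ∪ {□¬B} and let Req Γ T = {A, □A | ¬A ▷ ⋁¬S' ∈ Γ, S' ⊆ T finite},
-- so that Γ ≺_T Δ holds as soon as Req Γ T ⊆ Δ.  Take Δ to be a Lindenbaum
-- extension of Req Γ T ∪ {D}, where D = C ∧ □¬C.  Suppose finitely many
-- A₁,…,Aₙ ∈ Req Γ T refuted D.  Each ¬Aᵢ interprets some ⋁¬S'ᵢ in Γ (for □A
-- through ¬□A ▷ ¬A, a consequence of J5), so Z = ¬A₁ ∨ … ∨ ¬Aₙ is "bounded":
-- Z ▷ ⋁¬S' ∈ Γ for one finite S' ⊆ T (J3).  Then B ▷ C ▷ D ▷ Z ▷ ⋁¬S' in Γ,
-- where C ▷ D is W applied to C ▷ C and D ▷ Z is J1.  A second use of W gives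
-- B ▷ ⋁¬S' ∧ □¬B, which discards the disjuncts ¬□¬B: ¬¬B ▷ ⋁¬S₁ with S₁ ⊆ S.
-- Now Γ ≺_S Λ puts ¬B into Λ, contradicting B ∈ Λ.

open import Defs
open import Data.Bool using (Bool; true; false; not; _∨_)
open import Data.Empty using (⊥)
open import Data.List using (List; []; _∷_; _++_)
open import Data.List.Relation.Unary.All using (All; []; _∷_) renaming (map to All-map)
open import Data.List.Relation.Unary.All.Properties using (++⁺; ++⁻)
open import Data.Nat using (ℕ; zero; suc; _⊔_; _≤′_; ≤′-reflexive; ≤′-step)
open import Data.Nat.Properties using (m≤m⊔n; m≤n⊔m; ≤⇒≤′)
open import Data.Nat.Binary using (ℕᵇ; 2[1+_]; 1+[2_]; toℕ) renaming (zero to 0ᵇ)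
open import Data.Nat.Binary.Properties using (toℕ-injective)
open import Data.Product using (Σ; _×_; _,_; proj₁; proj₂)
open import Data.Sum using (_⊎_; inj₁; inj₂; [_,_]′) renaming (map to ⊎-map; map₂ to ⊎-map₂)
open import Function using (id)
open import Relation.Binary.PropositionalEquality using (_≡_; refl; sym; trans; subst)

→ᵇ-elim : ∀ a b → not a ∨ b ≡ true → a ≡ true → b ≡ true
→ᵇ-elim true b h refl = h

→ᵇ-intro : ∀ a b → (a ≡ true → b ≡ true) → not a ∨ b ≡ true
→ᵇ-intro false b f = refl
→ᵇ-intro true b f = f refl

record _⊩_ (v : Fm → Bool) (X : Fm) : Set where
  constructor holds
  field truth : eval v X ≡ true
open _⊩_

_⊨_ : List Fm → Fm → Set
Fs ⊨ X = ∀ v → All (v ⊩_) Fs → v ⊩ X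

module _ {v : Fm → Bool} where
  ⊥'-elim : ∀ {X} → v ⊩ ⊥' → v ⊩ X
  ⊥'-elim (holds ())

  ⇒-elim : ∀ {X Y} → v ⊩ (X ⇒ Y) → v ⊩ X → v ⊩ Y
  ⇒-elim {X} {Y} (holds h) (holds x) = holds (→ᵇ-elim (eval v X) (eval v Y) h x)

  ⇒-intro : ∀ {X Y} → (v ⊩ X → v ⊩ Y) → v ⊩ (X ⇒ Y)
  ⇒-intro {X} {Y} f = holds (→ᵇ-intro (eval v X) (eval v Y) (λ x → truth (f (holds x))))

  excluded-middle : ∀ X → v ⊩ X ⊎ v ⊩ ¬' X
  excluded-middle X with eval v X in eq
  ... | true = inj₁ (holds eq)
  ... | false = inj₂ (holds (subst (λ a → not a ∨ false ≡ true) (sym eq) refl))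

  ¬¬-elim : ∀ {X} → v ⊩ ¬' (¬' X) → v ⊩ X
  ¬¬-elim {X} nn = [ id , (λ n → ⊥'-elim (⇒-elim nn n)) ]′ (excluded-middle X)

  ∧-intro : ∀ {X Y} → v ⊩ X → v ⊩ Y → v ⊩ (X ∧' Y)
  ∧-intro x y = ⇒-intro λ h → ⇒-elim (⇒-elim h x) y

  ∧-elim₁ : ∀ {X Y} → v ⊩ (X ∧' Y) → v ⊩ X
  ∧-elim₁ h = ¬¬-elim (⇒-intro λ n → ⇒-elim h (⇒-intro λ x → ⊥'-elim (⇒-elim n x)))

  ∧-elim₂ : ∀ {X Y} → v ⊩ (X ∧' Y) → v ⊩ Y
  ∧-elim₂ h = ¬¬-elim (⇒-intro λ n → ⇒-elim h (⇒-intro λ _ → n))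

  ∨-intro₁ : ∀ {X Y} → v ⊩ X → v ⊩ (X ∨' Y)
  ∨-intro₁ x = ⇒-intro λ n → ⊥'-elim (⇒-elim n x)

  ∨-intro₂ : ∀ {X Y} → v ⊩ Y → v ⊩ (X ∨' Y)
  ∨-intro₂ y = ⇒-intro λ _ → y

  ∨-elim : ∀ {X Y} → v ⊩ (X ∨' Y) → v ⊩ X ⊎ v ⊩ Y
  ∨-elim {X} h = ⊎-map₂ (⇒-elim h) (excluded-middle X)

  ⇒*-intro : ∀ Fs {X} → (All (v ⊩_) Fs → v ⊩ X) → v ⊩ (Fs ⇒* X)
  ⇒*-intro [] f = f []
  ⇒*-intro (F ∷ Fs) f = ⇒-intro λ x → ⇒*-intro Fs λ xs → f (x ∷ xs)

  ⇒*-elim : ∀ {Fs X} → v ⊩ (Fs ⇒* X) → All (v ⊩_) Fs → v ⊩ X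
  ⇒*-elim h [] = h
  ⇒*-elim h (x ∷ xs) = ⇒*-elim (⇒-elim h x) xs

-- Propositional reasoning in L: every tautology is an axiom of IL.
module Derivations (L : Logic) where

  mp* : ∀ {Fs X} → Thm L (Fs ⇒* X) → All (Thm L) Fs → Thm L X
  mp* t [] = t
  mp* t (p ∷ ps) = mp* (mp L t p) ps

  by-taut : ∀ {Fs X} → All (Thm L) Fs → Fs ⊨ X → Thm L X
  by-taut {Fs} ps e = mp* (ax L (taut λ v → truth (⇒*-intro Fs (e v)))) ps

  taut-⇒ : ∀ {X Y} → (∀ v → v ⊩ X → v ⊩ Y) → Thm L (X ⇒ Y)
  taut-⇒ f = by-taut [] λ v [] → ⇒-intro (f v)

  separate : ∀ {Π X Ys} → All (Π ∪｛ X ｝) Ys →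
    Σ (List Fm) λ Ps → All Π Ps × (∀ v → v ⊩ X → All (v ⊩_) Ps → All (v ⊩_) Ys)
  separate [] = [] , [] , λ _ _ _ → []
  separate (inj₁ p ∷ a) with separate a
  ... | Ps , aP , f = _ ∷ Ps , p ∷ aP , λ { v x (h ∷ hs) → h ∷ f v x hs }
  separate (inj₂ refl ∷ a) with separate a
  ... | Ps , aP , f = Ps , aP , λ v x hs → x ∷ f v x hs

  consistent-∪ : ∀ {Π X} → (∀ {Ps} → All Π Ps → Thm L (Ps ⇒* ¬' X) → ⊥) →
    Consistent L (Π ∪｛ X ｝)
  consistent-∪ refute (Ys , a , t) with separate a
  ... | Ps , aP , f = refute aP (by-taut (t ∷ []) λ { v (h ∷ []) →
          ⇒*-intro Ps λ hs → ⇒-intro λ x → ⇒*-elim h (f v x hs) })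

module MaximalConsistent (L : Logic) (Γ : FmSet) (mΓ : MCS L Γ) where
  open Derivations L

  closed : ∀ {Fs X} → All Γ Fs → Thm L (Fs ⇒* X) → Γ X
  closed {Fs} {X} aF t = proj₂ mΓ (Γ ∪｛ X ｝) inj₁ (consistent-∪ refute) (inj₂ refl)
    where
      refute : ∀ {Ps} → All Γ Ps → Thm L (Ps ⇒* ¬' X) → ⊥
      refute {Ps} aP t' = proj₁ mΓ (Fs ++ Ps , ++⁺ aF aP ,
        by-taut (t ∷ t' ∷ []) λ { v (x ∷ ¬x ∷ []) → ⇒*-intro (Fs ++ Ps) λ hs →
          ⇒-elim (⇒*-elim ¬x (proj₂ (++⁻ Fs hs))) (⇒*-elim x (proj₁ (++⁻ Fs hs))) })

  entailed : ∀ {Fs X} → All Γ Fs → Fs ⊨ X → Γ X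
  entailed aF e = closed aF (by-taut [] λ v [] → ⇒*-intro _ (e v))

  theorem : ∀ {X} → Thm L X → Γ X
  theorem t = closed [] t

  mp-in : ∀ {X Y} → Γ (X ⇒ Y) → Γ X → Γ Y
  mp-in g x = entailed (g ∷ x ∷ []) λ { v (h ∷ h' ∷ []) → ⇒-elim h h' }

  ∧-in : ∀ {X Y} → Γ X → Γ Y → Γ (X ∧' Y)
  ∧-in x y = entailed (x ∷ y ∷ []) λ { v (h ∷ h' ∷ []) → ∧-intro h h' }

  not-both : ∀ {X} → Γ X → Γ (¬' X) → ⊥
  not-both {X} x ¬x = proj₁ mΓ (X ∷ ¬' X ∷ [] , x ∷ ¬x ∷ [] ,
    by-taut [] λ v [] → ⇒-intro λ h → ⇒-intro λ n → ⇒-elim n h)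

  ▷-intro : ∀ {X Y} → Thm L (X ⇒ Y) → Γ (X ▷ Y)
  ▷-intro {X} {Y} t = mp-in (theorem (ax L (axJ1 X Y))) (theorem (nec L t))

  ▷-trans : ∀ {X Y Z} → Γ (X ▷ Y) → Γ (Y ▷ Z) → Γ (X ▷ Z)
  ▷-trans {X} {Y} {Z} g g' = mp-in (theorem (ax L (axJ2 X Y Z))) (∧-in g g')

  ▷-∨ : ∀ {X Y Z} → Γ (X ▷ Z) → Γ (Y ▷ Z) → Γ ((X ∨' Y) ▷ Z)
  ▷-∨ {X} {Y} {Z} g g' = mp-in (theorem (ax L (axJ3 X Y Z))) (∧-in g g')

  ▷-weaken : ∀ {X Y Z} → Γ (X ▷ Y) → Thm L (Y ⇒ Z) → Γ (X ▷ Z)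
  ▷-weaken g t = ▷-trans g (▷-intro t)

  ▷-strengthen : ∀ {X Y Z} → Thm L (X ⇒ Y) → Γ (Y ▷ Z) → Γ (X ▷ Z)
  ▷-strengthen t g = ▷-trans (▷-intro t) g

  -- ¬□A ▷ ¬A: ¬□A implies ◇¬A by K, and ◇¬A ▷ ¬A is J5.
  ¬□▷¬ : ∀ A → Γ (¬' (□ A) ▷ ¬' A)
  ¬□▷¬ A = ▷-trans (▷-intro ¬□⇒◇¬) (theorem (ax L (axJ5 (¬' A))))
    where
      ¬□⇒◇¬ : Thm L (¬' (□ A) ⇒ ◇ (¬' A))
      ¬□⇒◇¬ = by-taut (ax L (axK (¬' (¬' A)) A) ∷ nec L (taut-⇒ λ v → ¬¬-elim) ∷ [])
        λ { v (k ∷ n ∷ []) → ⇒-intro λ ¬□ → ⇒-intro λ □¬¬ → ⇒-elim ¬□ (⇒-elim (⇒-elim k n) □¬¬) }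

  ▷-W : (∀ A B → Thm L (W A B)) → ∀ {X Y} → Γ (X ▷ Y) → Γ (X ▷ (Y ∧' □ (¬' X)))
  ▷-W w {X} {Y} g = mp-in (theorem (w X Y)) g

-- A prefix-free binary code, written with the two digits of bijective binary
-- numerals: tags 2, 12, 112, 1112, 1111 for var, ⊥', ⇒, □, ▷, and a variable
-- index n in unary as 1ⁿ2.  The second argument is the rest of the stream.
unary : ℕ → ℕᵇ → ℕᵇ
unary zero r = 2[1+ r ]
unary (suc n) r = 1+[2 unary n r ]

encode : Fm → ℕᵇ → ℕᵇ
encode (var n) r = 2[1+ unary n r ]
encode ⊥' r = 1+[2 2[1+ r ] ]
encode (A ⇒ B) r = 1+[2 1+[2 2[1+ encode A (encode B r) ] ] ]
encode (□ A) r = 1+[2 1+[2 1+[2 2[1+ encode A r ] ] ] ]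
encode (A ▷ B) r = 1+[2 1+[2 1+[2 1+[2 encode A (encode B r) ] ] ] ]

2[1+]-injective : ∀ {x y} → 2[1+ x ] ≡ 2[1+ y ] → x ≡ y
2[1+]-injective refl = refl

1+[2]-injective : ∀ {x y} → 1+[2 x ] ≡ 1+[2 y ] → x ≡ y
1+[2]-injective refl = refl

unary-injective : ∀ m n {r s} → unary m r ≡ unary n s → m ≡ n × r ≡ s
unary-injective zero zero eq = refl , 2[1+]-injective eq
unary-injective (suc m) (suc n) eq with unary-injective m n (1+[2]-injective eq)
... | refl , refl = refl , refl

-- Prefix-freeness: a stream determines the formula it starts with and its rest.
-- Clauses with different outer connectives are absurd (the tags differ).
encode-injective : ∀ A A' {r s} → encode A r ≡ encode A' s → A ≡ A' × r ≡ s
encode-injective (var m) (var n) eq with unary-injective m n (2[1+]-injective eq)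
... | refl , refl = refl , refl
encode-injective ⊥' ⊥' refl = refl , refl
encode-injective (A ⇒ B) (A' ⇒ B') eq
  with encode-injective A A' (2[1+]-injective (1+[2]-injective (1+[2]-injective eq)))
... | refl , eq' with encode-injective B B' eq'
... | refl , refl = refl , refl
encode-injective (□ A) (□ A') eq
  with encode-injective A A'
         (2[1+]-injective (1+[2]-injective (1+[2]-injective (1+[2]-injective eq))))
... | refl , refl = refl , refl
encode-injective (A ▷ B) (A' ▷ B') eq
  with encode-injective A A'
         (1+[2]-injective (1+[2]-injective (1+[2]-injective (1+[2]-injective eq))))
... | refl , eq' with encode-injective B B' eq'
... | refl , refl = refl , refl

code : Fm → ℕ
code A = toℕ (encode A 0ᵇ)

code-injective : ∀ {A B} → code A ≡ code B → A ≡ B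
code-injective {A} {B} eq = proj₁ (encode-injective A B (toℕ-injective eq))

-- Stage n+1 admits the formula with code n if that keeps stage n consistent.
-- No decision procedure is needed: admission is itself a proposition.
module Lindenbaum (L : Logic) (Σ₀ : FmSet) (cons₀ : Consistent L Σ₀) where

  stage : ℕ → FmSet
  stage zero = Σ₀
  stage (suc n) x = stage n x ⊎ (code x ≡ n × Consistent L (stage n ∪｛ x ｝))

  admitted-once : ∀ {n x y} → code x ≡ n → stage (suc n) y → (stage n ∪｛ x ｝) y
  admitted-once cx (inj₁ s) = inj₁ s
  admitted-once cx (inj₂ (cy , _)) = inj₂ (code-injective (trans cy (sym cx)))

  split : ∀ {n As} → All (stage (suc n)) As →
    All (stage n) As ⊎ Σ Fm λ x → Consistent L (stage n ∪｛ x ｝) × All (stage n ∪｛ x ｝) As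
  split [] = inj₁ []
  split (inj₁ s ∷ a) = ⊎-map (s ∷_) (λ (x , c , a') → x , c , inj₁ s ∷ a') (split a)
  split {As = y ∷ _} (inj₂ (cy , c) ∷ a) = inj₂ (y , c , inj₂ refl ∷ All-map (admitted-once cy) a)

  stage-consistent : ∀ n → Consistent L (stage n)
  stage-consistent zero = cons₀
  stage-consistent (suc n) (As , a , t) with split a
  ... | inj₁ a' = stage-consistent n (As , a' , t)
  ... | inj₂ (_ , c , a') = c (As , a' , t)

  stage-mono : ∀ {n m} → n ≤′ m → stage n ⊆ stage m
  stage-mono (≤′-reflexive refl) s = s
  stage-mono (≤′-step le) s = inj₁ (stage-mono le s)

  Δ : FmSet
  Δ x = Σ ℕ λ n → stage n x

  common-stage : ∀ {As} → All Δ As → Σ ℕ λ n → All (stage n) As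
  common-stage [] = 0 , []
  common-stage ((n , s) ∷ a) with common-stage a
  ... | m , a' = n ⊔ m , stage-mono (≤⇒≤′ (m≤m⊔n n m)) s ∷ All-map (stage-mono (≤⇒≤′ (m≤n⊔m n m))) a'

  Δ-consistent : Consistent L Δ
  Δ-consistent (As , a , t) with common-stage a
  ... | n , a' = stage-consistent n (As , a' , t)

  -- A consistent Δ' ⊇ Δ contains each of its members x together with stage
  -- (code x), so x was admitted at that step.
  Δ-maximal : (Δ' : FmSet) → Δ ⊆ Δ' → Consistent L Δ' → Δ' ⊆ Δ
  Δ-maximal Δ' sub c' {x} x∈Δ' =
    suc (code x) , inj₂ (refl , λ (As , a , t) → c' (As , All-map into a , t))
    where
      into : ∀ {y} → (stage (code x) ∪｛ x ｝) y → Δ' y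
      into (inj₁ s) = sub (code x , s)
      into (inj₂ refl) = x∈Δ'

lindenbaum : (L : Logic) (Σ₀ : FmSet) → Consistent L Σ₀ →
  Σ FmSet λ Δ → MCS L Δ × Σ₀ ⊆ Δ
lindenbaum L Σ₀ c = Δ , (Δ-consistent , Δ-maximal) , (λ s → 0 , s)
  where open Lindenbaum L Σ₀ c

module _ {v : Fm → Bool} where
  ⋁¬-++ˡ : ∀ xs ys → v ⊩ ⋁¬ xs → v ⊩ ⋁¬ (xs ++ ys)
  ⋁¬-++ˡ [] ys h = ⊥'-elim h
  ⋁¬-++ˡ (x ∷ xs) ys h = [ ∨-intro₁ , (λ r → ∨-intro₂ (⋁¬-++ˡ xs ys r)) ]′ (∨-elim h)

  ⋁¬-++ʳ : ∀ xs ys → v ⊩ ⋁¬ ys → v ⊩ ⋁¬ (xs ++ ys)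
  ⋁¬-++ʳ [] ys h = h
  ⋁¬-++ʳ (x ∷ xs) ys h = ∨-intro₂ (⋁¬-++ʳ xs ys h)

⋁¬-drop : ∀ {S σ S'} → All (S ∪｛ σ ｝) S' →
  Σ (List Fm) λ S₁ → All S S₁ × (∀ v → v ⊩ ⋁¬ S' → v ⊩ σ → v ⊩ ⋁¬ S₁)
⋁¬-drop [] = [] , [] , λ v h _ → h
⋁¬-drop (inj₁ s ∷ a) with ⋁¬-drop a
... | S₁ , aS , f = _ ∷ S₁ , s ∷ aS , λ v h σ →
  [ ∨-intro₁ , (λ r → ∨-intro₂ (f v r σ)) ]′ (∨-elim h)
⋁¬-drop (inj₂ refl ∷ a) with ⋁¬-drop a
... | S₁ , aS , f = S₁ , aS , λ v h σ →
  [ (λ ¬σ → ⊥'-elim (⇒-elim ¬σ σ)) , (λ r → f v r σ) ]′ (∨-elim h)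

Req : FmSet → FmSet → FmSet
Req Γ T y = Σ Fm λ A → Σ (List Fm) λ S' →
  All T S' × Γ (¬' A ▷ ⋁¬ S') × (y ≡ A ⊎ y ≡ □ A)

Req⊆⇒Prec : ∀ {Γ T Δ} → Req Γ T ⊆ Δ → Prec T Γ Δ
Req⊆⇒Prec sub A S' aS' g = sub (A , S' , aS' , g , inj₁ refl) , sub (A , S' , aS' , g , inj₂ refl)

Bounded : FmSet → FmSet → Fm → Set
Bounded Γ T Z = Σ (List Fm) λ S' → All T S' × Γ (Z ▷ ⋁¬ S')

module Requirements (L : Logic) (Γ : FmSet) (mΓ : MCS L Γ) (T : FmSet) where
  open Derivations L
  open MaximalConsistent L Γ mΓ

  ⊥-bounded : Bounded Γ T ⊥'
  ⊥-bounded = [] , [] , ▷-intro (taut-⇒ λ v h → h)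

  ∨-bounded : ∀ {X Y} → Bounded Γ T X → Bounded Γ T Y → Bounded Γ T (X ∨' Y)
  ∨-bounded (S₁ , a₁ , g₁) (S₂ , a₂ , g₂) = S₁ ++ S₂ , ++⁺ a₁ a₂ ,
    ▷-∨ (▷-weaken g₁ (taut-⇒ λ v → ⋁¬-++ˡ S₁ S₂)) (▷-weaken g₂ (taut-⇒ λ v → ⋁¬-++ʳ S₁ S₂))

  ¬-bounded : ∀ {y} → Req Γ T y → Bounded Γ T (¬' y)
  ¬-bounded (A , S' , aS' , g , inj₁ refl) = S' , aS' , g
  ¬-bounded (A , S' , aS' , g , inj₂ refl) = S' , aS' , ▷-trans (¬□▷¬ A) g

  requirements-cover : ∀ {Ys} → All (Req Γ T) Ys →
    Σ Fm λ Z → Bounded Γ T Z × (∀ v → v ⊩ Z ⊎ All (v ⊩_) Ys)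
  requirements-cover [] = ⊥' , ⊥-bounded , λ v → inj₂ []
  requirements-cover {y ∷ _} (r ∷ a) with requirements-cover a
  ... | Z , bZ , cover = ¬' y ∨' Z , ∨-bounded (¬-bounded r) bZ , λ v →
    [ (λ h → ⊎-map ∨-intro₂ (h ∷_) (cover v)) , (λ n → inj₁ (∨-intro₁ n)) ]′ (excluded-middle y)

module _ (L : Logic) (w : ∀ A B → Thm L (W A B)) where
  open Derivations L

  discharge-□¬ : ∀ {Γ S B S'} → MCS L Γ → All (S ∪｛ □ (¬' B) ｝) S' → Γ (B ▷ ⋁¬ S') →
    Σ (List Fm) λ S₁ → All S S₁ × Γ (¬' (¬' B) ▷ ⋁¬ S₁)
  discharge-□¬ mΓ aS' g with ⋁¬-drop aS'
  ... | S₁ , aS₁ , drop = S₁ , aS₁ ,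
    ▷-strengthen (taut-⇒ λ v → ¬¬-elim)
      (▷-weaken (▷-W w g) (taut-⇒ λ v h → drop v (∧-elim₁ h) (∧-elim₂ h)))
    where open MaximalConsistent L _ mΓ

  requirements-consistent : ∀ {Γ Λ S B C} → MCS L Γ → MCS L Λ →
    Γ (B ▷ C) → Prec S Γ Λ → Λ B →
    Consistent L (Req Γ (S ∪｛ □ (¬' B) ｝) ∪｛ C ∧' □ (¬' C) ｝)
  requirements-consistent {Γ} {Λ} {S} {B} {C} mΓ mΛ B▷C prec b = consistent-∪ refute
    where
      open MaximalConsistent L Γ mΓ
      open Requirements L Γ mΓ (S ∪｛ □ (¬' B) ｝)
      D : Fm
      D = C ∧' □ (¬' C)

      refute : ∀ {Ps} → All (Req Γ (S ∪｛ □ (¬' B) ｝)) Ps → Thm L (Ps ⇒* ¬' D) → ⊥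
      refute aP t with requirements-cover aP
      ... | Z , (S' , aS' , Z▷S') , cover =
        let (S₁ , aS₁ , ¬¬B▷S₁) = discharge-□¬ mΓ aS' B▷S'
        in MaximalConsistent.not-both L Λ mΛ b (proj₁ (prec (¬' B) S₁ aS₁ ¬¬B▷S₁))
        where
          D⇒Z : Thm L (D ⇒ Z)
          D⇒Z = by-taut (t ∷ []) λ { v (¬D ∷ []) → ⇒-intro λ d →
            [ id , (λ hs → ⊥'-elim (⇒-elim (⇒*-elim ¬D hs) d)) ]′ (cover v) }

          -- B ▷ C ▷ D ▷ Z ▷ ⋁¬S', where C ▷ D is W applied to C ▷ C.
          B▷S' : Γ (B ▷ ⋁¬ S')
          B▷S' = ▷-trans B▷C (▷-trans (▷-W w (▷-intro (taut-⇒ λ v h → h)))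
                   (▷-trans (▷-intro D⇒Z) Z▷S'))

lemma6p8 : (L : Logic) → (∀ A B → Thm L (W A B)) →
    (Γ Λ S : FmSet) (B C : Fm) →
    MCS L Γ → MCS L Λ → Γ (B ▷ C) → Prec S Γ Λ → Λ B →
    Σ FmSet λ Δ → MCS L Δ × Prec (S ∪｛ □ (¬' B) ｝) Γ Δ × Δ C × Δ (□ (¬' C))
lemma6p8 L w Γ Λ S B C mΓ mΛ B▷C prec b =
  let (Δ , mΔ , Σ₀⊆Δ) = lindenbaum L _ (requirements-consistent L w mΓ mΛ B▷C prec b)
      open MaximalConsistent L Δ mΔ
      D∈Δ : Δ (C ∧' □ (¬' C))
      D∈Δ = Σ₀⊆Δ (inj₂ refl)
  in Δ , mΔ , Req⊆⇒Prec {Γ} (λ r → Σ₀⊆Δ (inj₁ r)) ,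
     entailed (D∈Δ ∷ []) (λ { v (d ∷ []) → ∧-elim₁ d }) ,
     entailed (D∈Δ ∷ []) (λ { v (d ∷ []) → ∧-elim₂ d })
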